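{- Let $K$ be a finite complete graph whose edges are colored by elements of a finite set $\Gamma$, and let $S$ be the set of integers $n\geq 2$ such that $K$ contains no colorful $n$-cycle. Then $S$ is a submonoid of $\mathbb{N}(2)$, and $S$ is eventually solid, i.e., there is an $n$ such that $S$ contains every integer $k\geq n$.
   Context: An $n$-cycle ($n\geq 2$) in a graph is a sequence $(v_1,\dots,v_n)$ of distinct vertices; its edges are $v_iv_{i+1}$ with indices taken mod $n$. In an edge-colored graph a cycle is colorful if all its edges have pairwise distinct colors (a 2-cycle is never colorful, its two edges being the same edge). $\mathbb{N}(2)$ denotes the set $\{2,3,4,\dots\}$ with the operation $m\circ n=m+n-2$; it is a monoid with identity $2$, isomorphic to $(\mathbb{N},+)$ via $n\mapsto n-2$. -}

module Defs where

open import Data.Nat using (ℕ; zero; suc; _≤_; _+_; _∸_)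
open import Data.Nat.DivMod using (_mod_)
open import Data.Fin using (Fin; toℕ)
open import Data.Product using (Σ; _×_; ∃)
open import Relation.Binary.PropositionalEquality using (_≡_; _≢_)
open import Relation.Nullary using (¬_)
open import Function.Definitions using (Injective)

-- An edge {u,v} (u ≢ v) gets colour col u v; symmetry
-- expresses that the colour depends only on the (unordered) edge.  Values on
-- the diagonal (u = v) are irrelevant (loops are not edges).
record EdgeColouring (m c : ℕ) : Set where
  field
    col : Fin m → Fin m → Fin c
    col-sym : ∀ u v → u ≢ v → col u v ≡ col v u
open EdgeColouring public

next : ∀ {n} → Fin n → Fin n
next {suc n} i = suc (toℕ i) mod suc n

record ColourfulCycle {m c : ℕ} (K : EdgeColouring m c) (n : ℕ) : Set where
  field
    vert : Fin n → Fin m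
    distinct : Injective _≡_ _≡_ vert
    colourful : Injective _≡_ _≡_ (λ i → col K (vert i) (vert (next i)))

InS : ∀ {m c} → EdgeColouring m c → ℕ → Set
InS K n = (2 ≤ n) × ¬ ColourfulCycle K n

-- The monoid operation of ℕ(2): m ∘ n = m + n - 2
_∘₂_ : ℕ → ℕ → ℕ
a ∘₂ b = a + b ∸ 2

-- A chord of a colourful cycle splits it into two shorter cycles, each made of
-- one arc of the cycle closed up by the chord.  The colours of the two arcs are
-- pairwise distinct, so the colour of the chord occurs on at most one arc, and
-- the cycle closed up along the other arc is colourful.  For a cycle of length
-- a + b - 2 the chord can be chosen so that the pieces have lengths a and b;
-- hence if neither length admits a colourful cycle, neither does a + b - 2.
-- A cycle longer than the number of vertices cannot exist at all, and a 2-cycle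
-- uses the same edge twice.
module Submission where

open import Defs
open import Data.Nat using (ℕ; _≤_)
open import Data.Product using (_×_; ∃)

open import Data.Nat using (zero; suc; _+_; z≤n; s≤s)
open import Data.Nat.Properties using (≤-refl; ≤-trans; m≤n+m; +-suc; +-comm; suc-injective; <⇒≱)
open import Data.Nat.DivMod using (_%_; m<n⇒m%n≡m; n%n≡0)
open import Data.Fin using (Fin; toℕ; inject₁; fromℕ) renaming (zero to fzero; suc to fsuc)
open import Data.Fin.Properties
  using (_≟_; toℕ-injective; toℕ-fromℕ<; toℕ-inject₁; toℕ-fromℕ; toℕ<n; injective⇒≤)
open import Data.List using (List; []; _∷_; _++_; _∷ʳ_; length; tabulate; lookup)
open import Data.List.Properties using (++-assoc; length-++; length-tabulate; tabulate-lookup)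
open import Data.List.Relation.Unary.All using ([]; _∷_)
open import Data.List.Relation.Unary.All.Properties using (++⁻ˡ; ++⁻ʳ; ∷ʳ⁺; tabulate⁻)
open import Data.List.Relation.Unary.Unique.Propositional using (Unique; []; _∷_)
open import Data.List.Relation.Unary.Unique.Propositional.Properties using (tabulate⁺)
open import Data.Product using (Σ-syntax; _,_)
open import Data.Sum using (_⊎_; inj₁; inj₂; [_,_])
open import Function using (_∘_; case_of_)
open import Function.Definitions using (Injective)
open import Relation.Binary.Definitions using (DecidableEquality)
open import Relation.Binary.PropositionalEquality
  using (_≡_; _≢_; refl; sym; trans; cong; cong₂; subst; module ≡-Reasoning)
open import Relation.Nullary using (¬_; yes; no)

module _ {a} {A : Set a} where

  Unique-++⁻ˡ : ∀ xs {ys : List A} → Unique (xs ++ ys) → Unique xs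
  Unique-++⁻ˡ []       _          = []
  Unique-++⁻ˡ (x ∷ xs) (x∉ ∷ xs!) = ++⁻ˡ xs x∉ ∷ Unique-++⁻ˡ xs xs!

  Unique-++⁻ʳ : ∀ xs {ys : List A} → Unique (xs ++ ys) → Unique ys
  Unique-++⁻ʳ []       ys!       = ys!
  Unique-++⁻ʳ (x ∷ xs) (_ ∷ xs!) = Unique-++⁻ʳ xs xs!

  Unique-tabulate⁻ : ∀ {n} {f : Fin n → A} → Unique (tabulate f) → Injective _≡_ _≡_ f
  Unique-tabulate⁻ _            {fzero}  {fzero}  _  = refl
  Unique-tabulate⁻ (f0∉ ∷ _)    {fzero}  {fsuc j} eq = case tabulate⁻ f0∉ j eq of λ ()
  Unique-tabulate⁻ (f0∉ ∷ _)    {fsuc i} {fzero}  eq = case tabulate⁻ f0∉ i (sym eq) of λ ()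
  Unique-tabulate⁻ (_ ∷ fsuc!)  {fsuc i} {fsuc j} eq = cong fsuc (Unique-tabulate⁻ fsuc! eq)

  split-by-length : ∀ p {q} (xs : List A) → length xs ≡ p + suc q →
    Σ[ ys ∈ List A ] Σ[ u ∈ A ] Σ[ zs ∈ List A ]
      xs ≡ ys ++ u ∷ zs × length ys ≡ p × length zs ≡ q
  split-by-length zero    (u ∷ zs) |xs| = [] , u , zs , refl , refl , suc-injective |xs|
  split-by-length (suc p) (x ∷ xs) |xs| with split-by-length p xs (suc-injective |xs|)
  ... | ys , u , zs , refl , refl , |zs| = x ∷ ys , u , zs , refl , refl , |zs|

  -- z occurs in at most one of xs and ys, so it can be added to the other.
  Unique-++⇒∷ʳ⊎∷ : DecidableEquality A → ∀ xs {ys} z →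
    Unique (xs ++ ys) → Unique (xs ∷ʳ z) ⊎ Unique (z ∷ ys)
  Unique-++⇒∷ʳ⊎∷ _≟_ []       z _ = inj₁ ([] ∷ [])
  Unique-++⇒∷ʳ⊎∷ _≟_ (x ∷ xs) z (x∉ ∷ xs++ys!) with x ≟ z
  ... | yes refl = inj₂ (++⁻ʳ xs x∉ ∷ Unique-++⁻ʳ xs xs++ys!)
  ... | no x≢z with Unique-++⇒∷ʳ⊎∷ _≟_ xs z xs++ys!
  ...   | inj₁ xs∷ʳz! = inj₁ (∷ʳ⁺ (++⁻ˡ xs x∉) x≢z ∷ xs∷ʳz!)
  ...   | inj₂ z∷ys!  = inj₂ z∷ys!

next-inject₁ : ∀ {n} (i : Fin n) → next (inject₁ i) ≡ fsuc i
next-inject₁ {n} i = toℕ-injective (begin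
  toℕ (next (inject₁ i))        ≡⟨ toℕ-fromℕ< _ ⟩
  suc (toℕ (inject₁ i)) % suc n ≡⟨ cong (λ k → suc k % suc n) (toℕ-inject₁ i) ⟩
  suc (toℕ i) % suc n           ≡⟨ m<n⇒m%n≡m (s≤s (toℕ<n i)) ⟩
  suc (toℕ i)                   ∎)
  where open ≡-Reasoning

next-fromℕ : ∀ n → next (fromℕ n) ≡ fzero
next-fromℕ n = toℕ-injective (begin
  toℕ (next (fromℕ n))        ≡⟨ toℕ-fromℕ< _ ⟩
  suc (toℕ (fromℕ n)) % suc n ≡⟨ cong (λ k → suc k % suc n) (toℕ-fromℕ n) ⟩
  suc n % suc n               ≡⟨ n%n≡0 (suc n) ⟩
  0                           ∎)
  where open ≡-Reasoning

module _ {m c : ℕ} (K : EdgeColouring m c) where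

  pathColours : List (Fin m) → List (Fin c)
  pathColours (u ∷ v ∷ vs) = col K u v ∷ pathColours (v ∷ vs)
  pathColours _            = []

  cycleColours : List (Fin m) → List (Fin c)
  cycleColours []       = []
  cycleColours (v ∷ vs) = pathColours (v ∷ vs ∷ʳ v)

  IsColourfulCycle : List (Fin m) → Set
  IsColourfulCycle vs = Unique vs × Unique (cycleColours vs)

  pathColours-++ : ∀ xs u ys →
    pathColours (xs ++ u ∷ ys) ≡ pathColours (xs ∷ʳ u) ++ pathColours (u ∷ ys)
  pathColours-++ []           u ys = refl
  pathColours-++ (x ∷ [])     u ys = refl
  pathColours-++ (x ∷ y ∷ xs) u ys = cong (col K x y ∷_) (pathColours-++ (y ∷ xs) u ys)

  pathColours-tabulate : ∀ n (g h : Fin (suc n) → Fin m) w →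
    (∀ i → h (inject₁ i) ≡ g (fsuc i)) → h (fromℕ n) ≡ w →
    pathColours (tabulate g ∷ʳ w) ≡ tabulate (λ i → col K (g i) (h i))
  pathColours-tabulate zero    g h w _      h-last =
    cong (λ v → col K (g fzero) v ∷ []) (sym h-last)
  pathColours-tabulate (suc n) g h w h-init h-last =
    cong₂ _∷_ (cong (col K (g fzero)) (sym (h-init fzero)))
              (pathColours-tabulate n (g ∘ fsuc) (h ∘ fsuc) w (h-init ∘ fsuc) h-last)

  cycleColours-tabulate : ∀ {n} (f : Fin n → Fin m) →
    cycleColours (tabulate f) ≡ tabulate (λ i → col K (f i) (f (next i)))
  cycleColours-tabulate {zero}  f = refl
  cycleColours-tabulate {suc n} f =
    pathColours-tabulate n f (f ∘ next) (f fzero)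
      (λ i → cong f (next-inject₁ i)) (cong f (next-fromℕ n))

  colourfulCycle⇒isColourfulCycle : ∀ {n} (cc : ColourfulCycle K n) →
    IsColourfulCycle (tabulate (ColourfulCycle.vert cc))
  colourfulCycle⇒isColourfulCycle cc =
    tabulate⁺ distinct , subst Unique (sym (cycleColours-tabulate vert)) (tabulate⁺ colourful)
    where open ColourfulCycle cc

  isColourfulCycle⇒colourfulCycle : ∀ {vs} → IsColourfulCycle vs → ColourfulCycle K (length vs)
  isColourfulCycle⇒colourfulCycle {vs} (vs! , colours!) = record
    { vert      = lookup vs
    ; distinct  = Unique-tabulate⁻ (subst Unique (sym (tabulate-lookup vs)) vs!)
    ; colourful = Unique-tabulate⁻ (subst Unique (cycleColours-tabulate (lookup vs))
                    (subst (Unique ∘ cycleColours) (sym (tabulate-lookup vs)) colours!))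
    }

  isColourfulCycle-split : ∀ v xs u ys → IsColourfulCycle (v ∷ xs ++ u ∷ ys) →
    IsColourfulCycle (v ∷ xs ∷ʳ u) ⊎ IsColourfulCycle (v ∷ u ∷ ys)
  isColourfulCycle-split v xs u ys (vs!@(v∉ ∷ xs++u∷ys!) , colours!)
    with Unique-++⇒∷ʳ⊎∷ _≟_ arcˡ (col K u v) (subst Unique colours≡arcs colours!)
    where
    open ≡-Reasoning
    arcˡ arcʳ : List (Fin c)
    arcˡ = pathColours (v ∷ xs ∷ʳ u)
    arcʳ = pathColours (u ∷ ys ∷ʳ v)
    colours≡arcs : cycleColours (v ∷ xs ++ u ∷ ys) ≡ arcˡ ++ arcʳ
    colours≡arcs = begin
      pathColours ((v ∷ xs ++ u ∷ ys) ∷ʳ v)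
        ≡⟨ cong pathColours (++-assoc (v ∷ xs) (u ∷ ys) (v ∷ [])) ⟩
      pathColours ((v ∷ xs) ++ u ∷ ys ∷ʳ v) ≡⟨ pathColours-++ (v ∷ xs) u (ys ∷ʳ v) ⟩
      arcˡ ++ arcʳ                           ∎
  ... | inj₁ arcˡ∷ʳuv! = inj₁ (left-vertices! , subst Unique (sym left-colours) arcˡ∷ʳuv!)
    where
    left-vertices! : Unique (v ∷ xs ∷ʳ u)
    left-vertices! = Unique-++⁻ˡ (v ∷ xs ∷ʳ u)
      (subst Unique (cong (v ∷_) (sym (++-assoc xs (u ∷ []) ys))) vs!)
    left-colours : cycleColours (v ∷ xs ∷ʳ u) ≡ pathColours (v ∷ xs ∷ʳ u) ∷ʳ col K u v
    left-colours = trans (cong pathColours (++-assoc (v ∷ xs) (u ∷ []) (v ∷ [])))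
                         (pathColours-++ (v ∷ xs) u (v ∷ []))
  ... | inj₂ uv∷arcʳ! =
    inj₂ (right-vertices! , subst (λ χ → Unique (χ ∷ pathColours (u ∷ ys ∷ʳ v))) uv≡vu uv∷arcʳ!)
    where
    right-vertices! : Unique (v ∷ u ∷ ys)
    right-vertices! = ++⁻ʳ xs v∉ ∷ Unique-++⁻ʳ xs xs++u∷ys!
    uv≡vu : col K u v ≡ col K v u
    uv≡vu with right-vertices!
    ... | (v≢u ∷ _) ∷ _ = col-sym K u v (v≢u ∘ sym)

  colourfulCycle-split : ∀ p q → ColourfulCycle K (suc p + suc q) →
    ColourfulCycle K (2 + p) ⊎ ColourfulCycle K (2 + q)
  colourfulCycle-split p q cc@record { vert = vert }
    with split-by-length p (tabulate (vert ∘ fsuc)) (length-tabulate (vert ∘ fsuc))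
  ... | xs , u , ys , vs≡ , |xs| , |ys|
    with isColourfulCycle-split (vert fzero) xs u ys
           (subst IsColourfulCycle (cong (vert fzero ∷_) vs≡) (colourfulCycle⇒isColourfulCycle cc))
  ... | inj₁ left  = inj₁ (subst (ColourfulCycle K) |left| (isColourfulCycle⇒colourfulCycle left))
    where
    |left| : suc (length (xs ∷ʳ u)) ≡ 2 + p
    |left| = cong suc (trans (length-++ xs) (trans (+-comm (length xs) 1) (cong suc |xs|)))
  ... | inj₂ right =
    inj₂ (subst (ColourfulCycle K) (cong (2 +_) |ys|) (isColourfulCycle⇒colourfulCycle right))

  ¬colourfulCycle-2 : ¬ ColourfulCycle K 2
  ¬colourfulCycle-2 cc = case colourful (col-sym K (vert fzero) (vert (fsuc fzero)) v₀≢v₁) of λ ()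
    where
    open ColourfulCycle cc
    v₀≢v₁ : vert fzero ≢ vert (fsuc fzero)
    v₀≢v₁ eq = case distinct eq of λ ()

  colourfulCycle-length≤ : ∀ {n} → ColourfulCycle K n → n ≤ m
  colourfulCycle-length≤ cc = injective⇒≤ (ColourfulCycle.distinct cc)

  InS-∘₂ : ∀ {a b} → InS K a → InS K b → InS K (a ∘₂ b)
  InS-∘₂ {suc (suc a)} {suc (suc b)} (s≤s (s≤s z≤n) , ¬cycle-a) (s≤s (s≤s z≤n) , ¬cycle-b) =
    ≤-trans (s≤s (s≤s z≤n)) (m≤n+m (suc (suc b)) a) ,
    λ cc → [ ¬cycle-a , ¬cycle-b ]
             (colourfulCycle-split a b (subst (ColourfulCycle K) (+-suc a (suc b)) cc))

  InS-beyond-order : ∀ {k} → 2 + m ≤ k → InS K k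
  InS-beyond-order 2+m≤k = ≤-trans (s≤s (s≤s z≤n)) 2+m≤k ,
    λ cc → <⇒≱ (≤-trans (s≤s (m≤n+m m 1)) 2+m≤k) (colourfulCycle-length≤ cc)

mainTheorem1 : (m c : ℕ) (K : EdgeColouring m c) →
    (InS K 2 × (∀ a b → InS K a → InS K b → InS K (a ∘₂ b)))
    × ∃ (λ N → ∀ k → N ≤ k → InS K k)
mainTheorem1 m c K =
  ((≤-refl , ¬colourfulCycle-2 K) , λ _ _ → InS-∘₂ K) , (2 + m , λ _ → InS-beyond-order K)
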